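{- For all modal formulas $\phi,\psi$: $\Box(\phi\to\psi)\in\mathsf{CnK}$ if and only if $\phi\to\psi\in\mathsf{CnK}$.
   Context: Modal formulas are built from propositional letters with $\wedge,\vee,\to,\sim$ (strong negation), $\Box,\Diamond$. A modal Fischer-Servi model is $(W,\leq,R,V^+,V^-)$ with $W\neq\emptyset$, $\leq$ a preorder, $R\subseteq W\times W$, $V^\pm$ maps letters to $\leq$-upward closed subsets, satisfying (c1) $w\leq w'$, $wRv$ imply $w'Rv'$, $v\leq v'$ for some $v'$; (c2) $wRv$, $v\leq v'$ imply $w\leq w'$, $w'Rv'$ for some $w'$. Verification/falsification: $w\models^\pm p$ iff $w\in V^\pm(p)$; $\wedge$: $+$ iff both $+$, $-$ iff some $-$; $\vee$: $+$ iff some $+$, $-$ iff both $-$; $w\models^\pm\sim\psi$ iff $w\models^\mp\psi$; $w\models^+\psi\to\chi$ iff $\forall v\geq w(v\models^+\psi\Rightarrow v\models^+\chi)$; $w\models^-\psi\to\chi$ iff $\forall v\geq w(v\models^+\psi\Rightarrow v\models^-\chi)$; $w\models^\pm\Box\psi$ iff $\forall v\geq w\,\forall u(vRu\Rightarrow u\models^\pm\psi)$; $w\models^\pm\Diamond\psi$ iff $\exists u(wRu$ and $u\models^\pm\psi)$. $\phi\in\mathsf{CnK}$ iff $\phi$ is verified at every world of every such model. ($\Box(\phi\to\psi)$ is called strict implication $\phi\to_s\psi$.) -}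

module Defs where

open import Data.Nat using (ℕ)
open import Data.Product using (Σ; _×_; _,_; ∃)
open import Data.Sum using (_⊎_)
open import Level using (Level; suc; _⊔_)

data Form : Set where
  var  : ℕ → Form
  _∧_  : Form → Form → Form
  _∨_  : Form → Form → Form
  _⇒_  : Form → Form → Form
  ∼_   : Form → Form
  □_   : Form → Form
  ◇_   : Form → Form

infixr 5 _⇒_
infixr 6 _∨_
infixr 7 _∧_
infix 8 ∼_ □_ ◇_

record FSModel : Set₁ where
  field
    W      : Set
    inhabited : W
    _≤_    : W → W → Set
    ≤-refl  : ∀ {w} → w ≤ w
    ≤-trans : ∀ {u v w} → u ≤ v → v ≤ w → u ≤ w
    R      : W → W → Set
    V⁺     : ℕ → W → Set
    V⁻     : ℕ → W → Set
    V⁺-up  : ∀ {p w w'} → w ≤ w' → V⁺ p w → V⁺ p w'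
    V⁻-up  : ∀ {p w w'} → w ≤ w' → V⁻ p w → V⁻ p w'
    c1     : ∀ {w w' v} → w ≤ w' → R w v → Σ W (λ v' → R w' v' × v ≤ v')
    c2     : ∀ {w v v'} → R w v → v ≤ v' → Σ W (λ w' → w ≤ w' × R w' v')

module _ (M : FSModel) where
  open FSModel M

  -- verification (⊨⁺) and falsification (⊨⁻)
  _⊨⁺_ : W → Form → Set
  _⊨⁻_ : W → Form → Set

  w ⊨⁺ var p   = V⁺ p w
  w ⊨⁺ (φ ∧ ψ) = (w ⊨⁺ φ) × (w ⊨⁺ ψ)
  w ⊨⁺ (φ ∨ ψ) = (w ⊨⁺ φ) ⊎ (w ⊨⁺ ψ)
  w ⊨⁺ (φ ⇒ ψ) = ∀ v → w ≤ v → v ⊨⁺ φ → v ⊨⁺ ψ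
  w ⊨⁺ (∼ φ)   = w ⊨⁻ φ
  w ⊨⁺ (□ φ)   = ∀ v → w ≤ v → ∀ u → R v u → u ⊨⁺ φ
  w ⊨⁺ (◇ φ)   = Σ W (λ u → R w u × u ⊨⁺ φ)

  w ⊨⁻ var p   = V⁻ p w
  w ⊨⁻ (φ ∧ ψ) = (w ⊨⁻ φ) ⊎ (w ⊨⁻ ψ)
  w ⊨⁻ (φ ∨ ψ) = (w ⊨⁻ φ) × (w ⊨⁻ ψ)
  w ⊨⁻ (φ ⇒ ψ) = ∀ v → w ≤ v → v ⊨⁺ φ → v ⊨⁻ ψ
  w ⊨⁻ (∼ φ)   = w ⊨⁺ φ
  w ⊨⁻ (□ φ)   = ∀ v → w ≤ v → ∀ u → R v u → u ⊨⁻ φ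
  w ⊨⁻ (◇ φ)   = Σ W (λ u → R w u × u ⊨⁻ φ)

CnK : Form → Set₁
CnK φ = ∀ (M : FSModel) (w : FSModel.W M) → _⊨⁺_ M w φ

{-# OPTIONS --safe #-}
module Submission where

-- For the converse, add to a model a fresh
-- root that is ≤-related only to itself and R-sees every old world, and that
-- verifies and falsifies no letter. The old worlds form a generated submodel,
-- so they satisfy the same formulas as before; hence □ φ at the root yields
-- φ at every old world.

open import Defs
open import Data.Empty using (⊥)
open import Data.Nat using (ℕ)
open import Data.Product using (Σ; _×_; _,_)
open import Data.Sum using (inj₁; inj₂)
open import Data.Unit using (⊤; tt)

module RootExtension (M : FSModel) where
  open FSModel M

  data World : Set where
    root : World
    ⌜_⌝  : W → World

  _≼_ : World → World → Set
  root  ≼ root  = ⊤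
  ⌜ a ⌝ ≼ ⌜ b ⌝ = a ≤ b
  _     ≼ _     = ⊥

  Rʳ : World → World → Set
  Rʳ root  ⌜ _ ⌝ = ⊤
  Rʳ ⌜ a ⌝ ⌜ b ⌝ = R a b
  Rʳ _     _     = ⊥

  ≼-refl : ∀ {x} → x ≼ x
  ≼-refl {root}  = tt
  ≼-refl {⌜ _ ⌝} = ≤-refl

  ≼-trans : ∀ {x y z} → x ≼ y → y ≼ z → x ≼ z
  ≼-trans {root}  {root}  {root}  _ _ = tt
  ≼-trans {⌜ _ ⌝} {⌜ _ ⌝} {⌜ _ ⌝} p q = ≤-trans p q

  valuation : (ℕ → W → Set) → ℕ → World → Set
  valuation V p root  = ⊥
  valuation V p ⌜ a ⌝ = V p a

  valuation-up : {V : ℕ → W → Set} → (∀ {p a b} → a ≤ b → V p a → V p b) →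
                 ∀ {p x y} → x ≼ y → valuation V p x → valuation V p y
  valuation-up up {x = ⌜ _ ⌝} {⌜ _ ⌝} = up

  c1ʳ : ∀ {x x' y} → x ≼ x' → Rʳ x y → Σ World (λ y' → Rʳ x' y' × y ≼ y')
  c1ʳ {root}  {root}  {⌜ b ⌝} _ _ = ⌜ b ⌝ , tt , ≤-refl
  c1ʳ {⌜ _ ⌝} {⌜ _ ⌝} {⌜ _ ⌝} p r with c1 p r
  ... | b' , r' , q = ⌜ b' ⌝ , r' , q

  c2ʳ : ∀ {x y y'} → Rʳ x y → y ≼ y' → Σ World (λ x' → x ≼ x' × Rʳ x' y')
  c2ʳ {root}  {⌜ _ ⌝} {⌜ _ ⌝} _ _ = root , tt , tt
  c2ʳ {⌜ _ ⌝} {⌜ _ ⌝} {⌜ _ ⌝} r q with c2 r q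
  ... | a' , p , r' = ⌜ a' ⌝ , p , r'

  Mʳ : FSModel
  Mʳ = record
    { W         = World
    ; inhabited = root
    ; _≤_       = _≼_
    ; ≤-refl    = λ {x} → ≼-refl {x}
    ; ≤-trans   = λ {x} {y} {z} → ≼-trans {x} {y} {z}
    ; R         = Rʳ
    ; V⁺        = valuation V⁺
    ; V⁻        = valuation V⁻
    ; V⁺-up     = λ {p} {x} {y} → valuation-up V⁺-up {p} {x} {y}
    ; V⁻-up     = λ {p} {x} {y} → valuation-up V⁻-up {p} {x} {y}
    ; c1        = λ {x} {x'} {y} → c1ʳ {x} {x'} {y}
    ; c2        = λ {x} {y} {y'} → c2ʳ {x} {y} {y'}
    }

  lift⁺  : ∀ φ a → _⊨⁺_ M a φ → _⊨⁺_ Mʳ ⌜ a ⌝ φ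
  lift⁻  : ∀ φ a → _⊨⁻_ M a φ → _⊨⁻_ Mʳ ⌜ a ⌝ φ
  lower⁺ : ∀ φ a → _⊨⁺_ Mʳ ⌜ a ⌝ φ → _⊨⁺_ M a φ
  lower⁻ : ∀ φ a → _⊨⁻_ Mʳ ⌜ a ⌝ φ → _⊨⁻_ M a φ

  lift⁺ (var _) a h                  = h
  lift⁺ (φ ∧ ψ) a (h , k)            = lift⁺ φ a h , lift⁺ ψ a k
  lift⁺ (φ ∨ ψ) a (inj₁ h)           = inj₁ (lift⁺ φ a h)
  lift⁺ (φ ∨ ψ) a (inj₂ k)           = inj₂ (lift⁺ ψ a k)
  lift⁺ (φ ⇒ ψ) a h ⌜ b ⌝ p x        = lift⁺ ψ b (h b p (lower⁺ φ b x))
  lift⁺ (∼ φ)   a h                  = lift⁻ φ a h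
  lift⁺ (□ φ)   a h ⌜ b ⌝ p ⌜ c ⌝ r  = lift⁺ φ c (h b p c r)
  lift⁺ (◇ φ)   a (c , r , h)        = ⌜ c ⌝ , r , lift⁺ φ c h

  lift⁻ (var _) a h                  = h
  lift⁻ (φ ∧ ψ) a (inj₁ h)           = inj₁ (lift⁻ φ a h)
  lift⁻ (φ ∧ ψ) a (inj₂ k)           = inj₂ (lift⁻ ψ a k)
  lift⁻ (φ ∨ ψ) a (h , k)            = lift⁻ φ a h , lift⁻ ψ a k
  lift⁻ (φ ⇒ ψ) a h ⌜ b ⌝ p x        = lift⁻ ψ b (h b p (lower⁺ φ b x))
  lift⁻ (∼ φ)   a h                  = lift⁺ φ a h
  lift⁻ (□ φ)   a h ⌜ b ⌝ p ⌜ c ⌝ r  = lift⁻ φ c (h b p c r)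
  lift⁻ (◇ φ)   a (c , r , h)        = ⌜ c ⌝ , r , lift⁻ φ c h

  lower⁺ (var _) a h                 = h
  lower⁺ (φ ∧ ψ) a (h , k)           = lower⁺ φ a h , lower⁺ ψ a k
  lower⁺ (φ ∨ ψ) a (inj₁ h)          = inj₁ (lower⁺ φ a h)
  lower⁺ (φ ∨ ψ) a (inj₂ k)          = inj₂ (lower⁺ ψ a k)
  lower⁺ (φ ⇒ ψ) a h b p x           = lower⁺ ψ b (h ⌜ b ⌝ p (lift⁺ φ b x))
  lower⁺ (∼ φ)   a h                 = lower⁻ φ a h
  lower⁺ (□ φ)   a h b p c r         = lower⁺ φ c (h ⌜ b ⌝ p ⌜ c ⌝ r)
  lower⁺ (◇ φ)   a (⌜ c ⌝ , r , h)   = c , r , lower⁺ φ c h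

  lower⁻ (var _) a h                 = h
  lower⁻ (φ ∧ ψ) a (inj₁ h)          = inj₁ (lower⁻ φ a h)
  lower⁻ (φ ∧ ψ) a (inj₂ k)          = inj₂ (lower⁻ ψ a k)
  lower⁻ (φ ∨ ψ) a (h , k)           = lower⁻ φ a h , lower⁻ ψ a k
  lower⁻ (φ ⇒ ψ) a h b p x           = lower⁻ ψ b (h ⌜ b ⌝ p (lift⁺ φ b x))
  lower⁻ (∼ φ)   a h                 = lower⁺ φ a h
  lower⁻ (□ φ)   a h b p c r         = lower⁻ φ c (h ⌜ b ⌝ p ⌜ c ⌝ r)
  lower⁻ (◇ φ)   a (⌜ c ⌝ , r , h)   = c , r , lower⁻ φ c h

  root-⊨⁺-□ : ∀ φ a → _⊨⁺_ Mʳ root (□ φ) → _⊨⁺_ M a φ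
  root-⊨⁺-□ φ a h = lower⁺ φ a (h root tt ⌜ a ⌝ tt)

necessitation : ∀ φ → CnK φ → CnK (□ φ)
necessitation φ valid M _ _ _ u _ = valid M u

unnecessitation : ∀ φ → CnK (□ φ) → CnK φ
unnecessitation φ valid M a = root-⊨⁺-□ φ a (valid Mʳ root)
  where open RootExtension M

lemma4p18 : ∀ (φ ψ : Form) → (CnK (□ (φ ⇒ ψ)) → CnK (φ ⇒ ψ)) × (CnK (φ ⇒ ψ) → CnK (□ (φ ⇒ ψ)))
lemma4p18 φ ψ = unnecessitation (φ ⇒ ψ) , necessitation (φ ⇒ ψ)
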